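{- Let $T$ be an $\aleph_1$-tree and let $f\in\prod_{x\in T}[I(x)]^{<\omega}$. The following are equivalent: (1) the open cover $\mathcal U_f=\{\uparrow x\setminus\bigcup_{z\in f(x)}\uparrow z : x\in T\}$ of $T$ has no countable subcover; (2) for every $\alpha<\omega_1$ there is a point of height $\alpha$ which is safe for $f$; (3) the set $\{\mathrm{ht}(x):x\text{ is safe for }f\}$ is unbounded in $\omega_1$.
   Context: A tree is a strict partial order in which the predecessors of each node are well-ordered; an $\aleph_1$-tree has height $\omega_1$ and countable levels. $I(x)$ is the set of immediate successors of $x$, $[A]^{<\omega}$ the set of finite subsets of $A$, $\uparrow x=\{y\in T:x\le y\}$, and for a set $F$, $\uparrow F=\bigcup_{z\in F}\uparrow z$. The sets in $\mathcal U_f$ are open in the fine wedge topology (generated by the subbase of all $\uparrow t$ and their complements). A point $x\in T$ is safe for $f$ if for every $y<x$, $x\in\uparrow f(y)$. -}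

module Defs where

open import Data.Nat using (ℕ)
open import Data.Maybe using (Maybe; just)
open import Data.Product using (Σ; ∃; _×_; _,_)
open import Data.Sum using (_⊎_)
open import Data.List using (List)
open import Data.List.Relation.Unary.All using (All)
open import Data.List.Relation.Unary.Any using (Any)
open import Relation.Binary.PropositionalEquality using (_≡_)
open import Relation.Nullary using (¬_)
open import Induction.WellFounded using (WellFounded)

-- A type A is countable if there is a map ℕ → Maybe A hitting every element
-- (Maybe allows A to be empty or finite).
Countable : Set → Set
Countable A = Σ (ℕ → Maybe A) λ e → ∀ a → ∃ λ n → e n ≡ just a

record IsOmega1 (Ω : Set) (_≺_ : Ω → Ω → Set) : Set where
  field
    irrefl   : ∀ α → ¬ (α ≺ α)
    trans    : ∀ {α β γ} → α ≺ β → β ≺ γ → α ≺ γ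
    trichot  : ∀ α β → α ≺ β ⊎ α ≡ β ⊎ β ≺ α
    wf       : WellFounded _≺_
    uncountable   : ¬ Countable Ω
    segCountable  : ∀ α → Countable (Σ Ω λ β → β ≺ α)

_⪯_ : {Ω : Set} → (Ω → Ω → Set) → Ω → Ω → Set
_⪯_ _≺_ α β = α ≺ β ⊎ α ≡ β

-- (T, <) is a tree: a strict partial order whose sets of predecessors are
-- well-ordered (well-foundedness of < plus linearity of each predecessor set).
record IsTree (T : Set) (_<_ : T → T → Set) : Set where
  field
    irrefl  : ∀ x → ¬ (x < x)
    trans   : ∀ {x y z} → x < y → y < z → x < z
    wf      : WellFounded _<_
    predLin : ∀ {x y z} → y < x → z < x → y < z ⊎ y ≡ z ⊎ z < y

-- (T, <) is an ℵ₁-tree, with ω₁ represented by (Ω, ≺) and height function ht.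
-- ht x is the order type of the predecessors of x: ht is strictly monotone and
-- maps the predecessors of x onto the initial segment below ht x (together with
-- linearity of predecessors, this makes ht an order isomorphism from pred(x)
-- onto {β ≺ ht x}, which characterises the height uniquely).
record IsAleph1Tree (T : Set) (_<_ : T → T → Set)
                    (Ω : Set) (_≺_ : Ω → Ω → Set) (ht : T → Ω) : Set where
  field
    isTree   : IsTree T _<_
    isOmega1 : IsOmega1 Ω _≺_
    htMono   : ∀ {x y} → x < y → ht x ≺ ht y
    htOnto   : ∀ x β → β ≺ ht x → ∃ λ y → y < x × ht y ≡ β
    htAll    : ∀ α → ∃ λ x → ht x ≡ α
    levelsCountable : ∀ α → Countable (Σ T λ x → ht x ≡ α)

module _ {T : Set} (_<_ : T → T → Set) where

  _≤_ : T → T → Set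
  x ≤ y = x < y ⊎ x ≡ y

  I : T → T → Set
  I x y = x < y × ¬ (∃ λ z → x < z × z < y)

  -- f ∈ Π_{x∈T} [I(x)]^{<ω}, finite subsets represented as lists
  FinSucc : (T → List T) → Set
  FinSucc f = ∀ x → All (I x) (f x)

  InU : (T → List T) → T → T → Set
  InU f x t = x ≤ t × ¬ Any (λ z → z ≤ t) (f x)

  -- 𝒰_f has a countable subcover (T is nonempty, so a countable nonempty
  -- subfamily is indexed by a sequence of nodes)
  HasCountableSubcover : (T → List T) → Set
  HasCountableSubcover f = Σ (ℕ → T) λ s → ∀ t → ∃ λ n → InU f (s n) t

  Safe : (T → List T) → T → Set
  Safe f x = ∀ y → y < x → Any (λ z → z ≤ x) (f y)

{-# OPTIONS --safe #-}
module Submission where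

-- If x is
-- unsafe, witnessed by y < x with no element of f(y) below x, then U_y contains everything
-- above x; a safe x, on the other hand, lies in no U_y with y < x, only in U_x.  So if level α
-- has no safe node, the countably many U_y with ht y ⪯ α cover T; conversely a countable
-- subfamily has its heights bounded by some α < ω₁, and a safe node of height α escapes it.
-- Safe nodes are closed downwards, which makes (2) and (3) equivalent.

open import Defs hiding (_≤_)
open import Data.Product using (∃; _×_)
open import Relation.Binary.PropositionalEquality using (_≡_)
open import Relation.Nullary using (¬_)
open import Function.Bundles using (_⇔_)
open import Axiom.ExcludedMiddle using (ExcludedMiddle)
open import Level using (0ℓ)
open import Data.List using (List)

open import Axiom.DoubleNegationElimination using (em⇒dne)
open import Data.Empty using (⊥-elim)
open import Data.List.Membership.Propositional using (find; lose)
open import Data.List.Relation.Unary.All as All using (All)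
open import Data.List.Relation.Unary.Any using (Any)
open import Data.Maybe as Maybe using (Maybe; just; fromMaybe)
open import Data.Nat using (ℕ; zero; suc; _+_)
open import Data.Nat.Properties using (+-suc; +-identityʳ)
open import Data.Product using (Σ; _,_; proj₁; proj₂)
open import Data.Sum using (inj₁; inj₂)
open import Data.Unit using (⊤; tt)
open import Function.Bundles using (mk⇔)
open import Relation.Binary.PropositionalEquality using (refl; sym; cong; subst; trans; module ≡-Reasoning)

diagonal-step : ℕ × ℕ → ℕ × ℕ
diagonal-step (a , zero)  = 0 , suc a
diagonal-step (a , suc b) = suc a , b

-- Runs through each antidiagonal a + b = d from (0 , d) to (d , 0).
unpair : ℕ → ℕ × ℕ
unpair zero    = 0 , 0
unpair (suc n) = diagonal-step (unpair n)

unpair-hits : ℕ × ℕ → Set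
unpair-hits p = ∃ λ n → unpair n ≡ p

unpair-hits-along-diagonal : ∀ a b → unpair-hits (0 , a + b) → unpair-hits (a , b)
unpair-hits-along-diagonal zero    b h = h
unpair-hits-along-diagonal (suc a) b h
  with unpair-hits-along-diagonal a (suc b) (subst (λ d → unpair-hits (0 , d)) (sym (+-suc a b)) h)
... | n , eq = suc n , cong diagonal-step eq

unpair-hits-diagonal-start : ∀ d → unpair-hits (0 , d)
unpair-hits-diagonal-start zero = 0 , refl
unpair-hits-diagonal-start (suc d)
  with unpair-hits-along-diagonal d 0
         (subst (λ e → unpair-hits (0 , e)) (sym (+-identityʳ d)) (unpair-hits-diagonal-start d))
... | n , eq = suc n , cong diagonal-step eq

unpair-surjective : ∀ a b → unpair-hits (a , b)
unpair-surjective a b = unpair-hits-along-diagonal a b (unpair-hits-diagonal-start (a + b))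

Enumerable : {X : Set} → (X → Set) → Set
Enumerable {X} P = Σ (ℕ → Maybe X) λ e → ∀ x → P x → ∃ λ n → e n ≡ just x

ℕ-enumerable : Enumerable {ℕ} (λ _ → ⊤)
ℕ-enumerable = just , λ n _ → n , refl

Countable-Σ⇒Enumerable : {X : Set} {P : X → Set} → Countable (Σ X P) → Enumerable P
Countable-Σ⇒Enumerable (e , hit) =
  (λ n → Maybe.map proj₁ (e n)) , λ x p → let n , eq = hit (x , p) in n , cong (Maybe.map proj₁) eq

Enumerable⇒Countable : {X : Set} {P : X → Set} → Enumerable P → (∀ x → P x) → Countable X
Enumerable⇒Countable (e , hit) all = e , λ x → hit x (all x)

Enumerable⇒sequence : {X : Set} {P : X → Set} → X → Enumerable P →
                      Σ (ℕ → X) λ s → ∀ x → P x → ∃ λ n → s n ≡ x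
Enumerable⇒sequence d (e , hit) =
  (λ n → fromMaybe d (e n)) , λ x p → let n , eq = hit x p in n , cong (fromMaybe d) eq

module _ {A B : Set} {P : A → Set} {Q : A → B → Set} where

  Enumerable-⋃ : Enumerable P → (∀ a → Enumerable (Q a)) → Enumerable (λ b → ∃ λ a → P a × Q a b)
  Enumerable-⋃ (eA , hitA) eB = e , hit
    where
    enumerate-fibre : Maybe A → ℕ → Maybe B
    enumerate-fibre (just a) j = proj₁ (eB a) j
    enumerate-fibre _        _ = Maybe.nothing

    e : ℕ → Maybe B
    e n = enumerate-fibre (eA (proj₁ (unpair n))) (proj₂ (unpair n))

    hit : ∀ b → (∃ λ a → P a × Q a b) → ∃ λ n → e n ≡ just b
    hit b (a , pa , qab) with hitA a pa | proj₂ (eB a) b qab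
    ... | i , eAi≡a | j , ebj≡b with unpair-surjective i j
    ... | n , unpair-n≡ij = n , (begin
      e n                          ≡⟨ cong (λ (i′ , j′) → enumerate-fibre (eA i′) j′) unpair-n≡ij ⟩
      enumerate-fibre (eA i) j     ≡⟨ cong (λ m → enumerate-fibre m j) eAi≡a ⟩
      proj₁ (eB a) j               ≡⟨ ebj≡b ⟩
      just b                       ∎)
      where open ≡-Reasoning

Any-mapWithAll : {A : Set} {P Q R : A → Set} {xs : List A} →
                 (∀ {x} → P x → Q x → R x) → All P xs → Any Q xs → Any R xs
Any-mapWithAll k ps qs = let x , x∈xs , q = find qs in lose x∈xs (k (All.lookup ps x∈xs) q)

module Omega1 {Ω : Set} {_≺_ : Ω → Ω → Set} (ω₁ : IsOmega1 Ω _≺_) where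

  open IsOmega1 ω₁

  _≼_ : Ω → Ω → Set
  _≼_ = _⪯_ _≺_

  ⋠⇒≻ : ∀ {α β} → ¬ α ≼ β → β ≺ α
  ⋠⇒≻ {α} {β} α⋠β with trichot α β
  ... | inj₁ α≺β        = ⊥-elim (α⋠β (inj₁ α≺β))
  ... | inj₂ (inj₁ α≡β) = ⊥-elim (α⋠β (inj₂ α≡β))
  ... | inj₂ (inj₂ β≺α) = β≺α

  ≼-enumerable : ∀ α → Enumerable (_≼ α)
  ≼-enumerable α = e , hit
    where
    e : ℕ → Maybe Ω
    e zero    = just α
    e (suc n) = Maybe.map proj₁ (proj₁ (segCountable α) n)

    hit : ∀ β → β ≼ α → ∃ λ n → e n ≡ just β
    hit β (inj₂ refl) = 0 , refl
    hit β (inj₁ β≺α)  = let n , eq = proj₂ (segCountable α) (β , β≺α) in suc n , cong (Maybe.map proj₁) eq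

  sequence-bounded : ExcludedMiddle 0ℓ → (s : ℕ → Ω) → ∃ λ α → ∀ n → s n ≺ α
  sequence-bounded em s = em⇒dne em λ unbounded →
    let cofinal : ∀ α → ∃ λ n → ⊤ × α ≼ s n
        cofinal α = em⇒dne em λ none → unbounded (α , λ n → ⋠⇒≻ λ α≼sn → none (n , tt , α≼sn))
    in uncountable (Enumerable⇒Countable (Enumerable-⋃ ℕ-enumerable (λ n → ≼-enumerable (s n))) cofinal)

module Tree {T : Set} {_<_ : T → T → Set} (tree : IsTree T _<_) where

  open IsTree tree renaming (irrefl to <-irrefl; trans to <-trans)

  _≤_ : T → T → Set
  _≤_ = Defs._≤_ _<_

  <⇒≱ : ∀ {x y} → x < y → ¬ y ≤ x
  <⇒≱ x<y (inj₁ y<x)  = <-irrefl _ (<-trans x<y y<x)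
  <⇒≱ x<y (inj₂ refl) = <-irrefl _ x<y

  immediate-successor-below : ∀ {w u x z} → w < u → u < x → I _<_ w z → z ≤ x → z ≤ u
  immediate-successor-below w<u u<x (_ , nothing-between) (inj₂ refl) = ⊥-elim (nothing-between (_ , w<u , u<x))
  immediate-successor-below w<u u<x (_ , nothing-between) (inj₁ z<x) with predLin z<x u<x
  ... | inj₁ z<u        = inj₁ z<u
  ... | inj₂ (inj₁ z≡u) = inj₂ z≡u
  ... | inj₂ (inj₂ u<z) = ⊥-elim (nothing-between (_ , w<u , u<z))

  module _ {f : T → List T} (f-succ : FinSucc _<_ f) where

    f-below : ∀ {y u t} → y < u → u < t → Any (_≤ t) (f y) → Any (_≤ u) (f y)
    f-below y<u u<t = Any-mapWithAll (immediate-successor-below y<u u<t) (f-succ _)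

    InU-self : ∀ t → InU _<_ f t t
    InU-self t = inj₂ refl , λ some≤t →
      let z , z∈ft , z≤t = find some≤t in <⇒≱ (proj₁ (All.lookup (f-succ t) z∈ft)) z≤t

    InU-above-unsafe : ∀ {y u t} → y < u → u < t → ¬ Any (_≤ u) (f y) → InU _<_ f y t
    InU-above-unsafe y<u u<t none≤u = inj₁ (<-trans y<u u<t) , λ some≤t → none≤u (f-below y<u u<t some≤t)

    Safe-downward : ∀ {x y} → Safe _<_ f x → y < x → Safe _<_ f y
    Safe-downward safe y<x w w<y = f-below w<y y<x (safe w (<-trans w<y y<x))

    unsafe-witness : ExcludedMiddle 0ℓ → ∀ {u} → ¬ Safe _<_ f u → ∃ λ y → y < u × ¬ Any (_≤ u) (f y)
    unsafe-witness em unsafe = em⇒dne em λ none →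
      unsafe λ y y<u → em⇒dne em λ none≤u → none (y , y<u , none≤u)

module Aleph1Tree {T : Set} {_<_ : T → T → Set} {Ω : Set} {_≺_ : Ω → Ω → Set} {ht : T → Ω}
                  (A : IsAleph1Tree T _<_ Ω _≺_ ht) where

  open IsAleph1Tree A
  open IsOmega1 isOmega1 using (irrefl; trichot)
  open Omega1 isOmega1
  open Tree isTree

  SafeAtHeight : (T → List T) → Ω → Set
  SafeAtHeight f α = ∃ λ x → ht x ≡ α × Safe _<_ f x

  low-nodes-enumerable : ∀ α → Enumerable (λ x → ∃ λ β → β ≼ α × ht x ≡ β)
  low-nodes-enumerable α = Enumerable-⋃ (≼-enumerable α) (λ β → Countable-Σ⇒Enumerable (levelsCountable β))

  safe-at⇒safe-above : ∀ {f α} → SafeAtHeight f α → ∃ λ x → Safe _<_ f x × α ≼ ht x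
  safe-at⇒safe-above (x , htx≡α , safe) = x , safe , inj₂ (sym htx≡α)

  module _ {f : T → List T} (f-succ : FinSucc _<_ f) where

    safe-above⇒safe-at : ∀ {α} → (∃ λ x → Safe _<_ f x × α ≼ ht x) → SafeAtHeight f α
    safe-above⇒safe-at (x , safe , inj₂ refl)  = x , refl , safe
    safe-above⇒safe-at (x , safe , inj₁ α≺htx) =
      let y , y<x , hty≡α = htOnto x _ α≺htx in y , hty≡α , Safe-downward f-succ safe y<x

    no-safe-at⇒countable-subcover : ExcludedMiddle 0ℓ → ∀ α → ¬ SafeAtHeight f α → HasCountableSubcover _<_ f
    no-safe-at⇒countable-subcover em α no-safe = s , cover
      where
      low : Σ (ℕ → T) λ s → ∀ x → (∃ λ β → β ≼ α × ht x ≡ β) → ∃ λ n → s n ≡ x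
      low = Enumerable⇒sequence (proj₁ (htAll α)) (low-nodes-enumerable α)

      s : ℕ → T
      s = proj₁ low

      covered-by : ∀ {x t} → InU _<_ f x t → ht x ≼ α → ∃ λ n → InU _<_ f (s n) t
      covered-by {x} x∈U htx≼α =
        let n , sn≡x = proj₂ low x (ht x , htx≼α , refl) in n , subst (λ v → InU _<_ f v _) (sym sn≡x) x∈U

      cover : ∀ t → ∃ λ n → InU _<_ f (s n) t
      cover t with trichot (ht t) α
      ... | inj₁ htt≺α        = covered-by (InU-self f-succ t) (inj₁ htt≺α)
      ... | inj₂ (inj₁ htt≡α) = covered-by (InU-self f-succ t) (inj₂ htt≡α)
      ... | inj₂ (inj₂ α≺htt) with htOnto t α α≺htt
      ... | u , u<t , htu≡α with unsafe-witness f-succ em (λ safe → no-safe (u , htu≡α , safe))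
      ... | y , y<u , none≤u =
        covered-by (InU-above-unsafe f-succ y<u u<t none≤u) (inj₁ (subst (ht y ≺_) htu≡α (htMono y<u)))

    safe-at-every-height⇒no-countable-subcover :
      ExcludedMiddle 0ℓ → (∀ α → SafeAtHeight f α) → ¬ HasCountableSubcover _<_ f
    safe-at-every-height⇒no-countable-subcover em safe-at (s , cover)
      with sequence-bounded em (λ n → ht (s n))
    ... | α , bound with safe-at α
    ... | x , htx≡α , safe with cover x
    ... | n , inj₂ sn≡x , _   = irrefl α (subst (_≺ α) (trans (cong ht sn≡x) htx≡α) (bound n))
    ... | n , inj₁ sn<x , avoid = avoid (safe (s n) sn<x)

lemma4p8 : ExcludedMiddle 0ℓ →
    (T : Set) (_<_ : T → T → Set) (Ω : Set) (_≺_ : Ω → Ω → Set) (ht : T → Ω) →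
    IsAleph1Tree T _<_ Ω _≺_ ht →
    (f : T → List T) → FinSucc _<_ f →
    ((¬ HasCountableSubcover _<_ f) ⇔ (∀ α → ∃ λ x → ht x ≡ α × Safe _<_ f x))
    × ((∀ α → ∃ λ x → ht x ≡ α × Safe _<_ f x) ⇔ (∀ α → ∃ λ x → Safe _<_ f x × _⪯_ _≺_ α (ht x)))
lemma4p8 em T _<_ Ω _≺_ ht A f f-succ =
  mk⇔ (λ no-subcover α → em⇒dne em λ no-safe →
         no-subcover (no-safe-at⇒countable-subcover f-succ em α no-safe))
      (safe-at-every-height⇒no-countable-subcover f-succ em)
  , mk⇔ (λ safe-at α → safe-at⇒safe-above (safe-at α))
        (λ safe-above α → safe-above⇒safe-at f-succ (safe-above α))
  where open Aleph1Tree A
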